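{- Let $G$ be the bipartite graph on players and fat resources described below, and let $M$ and $M'$ be any two maximum matchings of $G$. Then (i) $f_M(\overline{P}_M,\overline{P}_{M'}) = |\overline{P}_M| = |\overline{P}_{M'}|$, and (ii) for every subset $T$ of players, $f_M(\overline{P}_M,T) = f_{M'}(\overline{P}_{M'},T)$.
   Context: Let $P$ be a set of players and $R_f$ a set of (fat) resources, and let $G$ be a bipartite graph with vertex set $P \cup R_f$ whose edges join players to resources. For a maximum matching $M$ of $G$, let $G_M$ be the directed graph obtained from $G$ by orienting each edge $(p,r)$ from $r$ to $p$ if $(p,r)\in M$ and from $p$ to $r$ otherwise. Let $\overline{P}_M \subseteq P$ be the set of players not matched by $M$. For $S \subseteq \overline{P}_M$ and $T \subseteq P$, $f_M(S,T)$ denotes the maximum number of pairwise vertex-disjoint directed paths in $G_M$ each starting at a vertex of $S$ and ending at a vertex of $T$; a single vertex of $S \cap T$ counts as a (trivial) path. -}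

module Defs where

open import Data.Nat using (ℕ; _≤_)
open import Data.Fin using (Fin)
open import Data.Bool using (Bool; T)
open import Data.Maybe using (Maybe; just; nothing; is-just; is-nothing)
open import Data.Sum using (_⊎_; inj₁; inj₂)
open import Data.Product using (Σ; _×_; _,_; ∃)
open import Data.List using (List; []; _∷_)
open import Data.List.Membership.Propositional using (_∈_)
open import Data.List.Relation.Unary.Unique.Propositional using (Unique)
open import Data.Vec using (tabulate)
open import Data.Fin.Subset using (Subset; ∣_∣) renaming (_∈_ to _∈ₛ_)
open import Relation.Nullary using (¬_)
open import Relation.Binary.PropositionalEquality using (_≡_)

-- A bipartite graph between players Fin n and (fat) resources Fin m,
-- given by its adjacency: player p and resource r are joined iff T (adj p r).
BGraph : ℕ → ℕ → Set
BGraph n m = Fin n → Fin m → Bool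

module _ {n m : ℕ} (adj : BGraph n m) where

  record Matching : Set where
    field
      mate  : Fin n → Maybe (Fin m)
      inE   : ∀ p r → mate p ≡ just r → T (adj p r)
      injct : ∀ p q r → mate p ≡ just r → mate q ≡ just r → p ≡ q
  open Matching public

  size : Matching → ℕ
  size M = ∣ tabulate (λ p → is-just (mate M p)) ∣

  IsMaximum : Matching → Set
  IsMaximum M = ∀ (M' : Matching) → size M' ≤ size M

  unmatched : Matching → Subset n
  unmatched M = tabulate (λ p → is-nothing (mate M p))

  V : Set
  V = Fin n ⊎ Fin m

  data Arc (M : Matching) : V → V → Set where
    fwd : ∀ {p r} → T (adj p r) → ¬ (mate M p ≡ just r) → Arc M (inj₁ p) (inj₂ r)
    bwd : ∀ {p r} → mate M p ≡ just r → Arc M (inj₂ r) (inj₁ p)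

  data Walk (M : Matching) : V → V → Set where
    []  : ∀ {u} → Walk M u u
    _∷_ : ∀ {u v w} → Arc M u v → Walk M v w → Walk M u w

  vertices : ∀ {M u v} → Walk M u v → List V
  vertices {u = u} []      = u ∷ []
  vertices {u = u} (_ ∷ w) = u ∷ vertices w

  -- a directed path in G_M from a player of S to a player of T
  -- (the trivial one-vertex path is allowed)
  record SPath (M : Matching) (S T : Subset n) : Set where
    field
      src   : Fin n
      tgt   : Fin n
      src∈S : src ∈ₛ S
      tgt∈T : tgt ∈ₛ T
      walk  : Walk M (inj₁ src) (inj₁ tgt)
      simple : Unique (vertices walk)
  open SPath public

  Disjoint : ∀ {M S T} → SPath M S T → SPath M S T → Set
  Disjoint π σ = ∀ x → x ∈ vertices (walk π) → ¬ (x ∈ vertices (walk σ))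

  DisjointPaths : Matching → Subset n → Subset n → ℕ → Set
  DisjointPaths M S T k =
    Σ (Fin k → SPath M S T) λ π → ∀ i j → ¬ (i ≡ j) → Disjoint (π i) (π j)

  fIs : Matching → Subset n → Subset n → ℕ → Set
  fIs M S T k = DisjointPaths M S T k × (∀ k' → DisjointPaths M S T k' → k' ≤ k)

module Submission where

-- The components of M ⊕ M′ through players unmatched by M are alternating paths. None of them can
-- end at a resource that M leaves free, for it would augment the maximum matching M, so each ends
-- at a player unmatched by M′; read forwards, they are |P̄_M| disjoint paths of G_M from P̄_M to
-- P̄_M′, and no family has more paths than it has distinct sources. For (ii), flipping k disjoint
-- paths of G_M from P̄_M to T gives a maximum matching N in which their targets are unmatched; the
-- alternating paths of N ⊕ M′ from these targets, read backwards, are k disjoint paths of G_M′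
-- from P̄_M′ to T. Simplicity and disjointness all come from one fact: walking an alternating path
-- backwards is deterministic, so a vertex determines where its path starts and how far along it is.

open import Defs
open import Data.Bool using (Bool; true; false; not; T)
open import Data.Empty using (⊥; ⊥-elim)
open import Data.Fin using (Fin; zero; suc; toℕ; join; splitAt)
open import Data.Fin.Properties
  using (_≟_; any?; injective⇒≤; suc-injective; toℕ-injective; toℕ≤pred[n]; splitAt-join)
open import Data.Fin.Subset using (Subset; ∣_∣) renaming (_∈_ to _∈ₛ_)
open import Data.Fin.Subset.Properties using (∣∁p∣≡n∸∣p∣)
open import Data.List using ([]; _∷_)
open import Data.List.Membership.Propositional using (_∈_; _∉_)
open import Data.List.Relation.Unary.All as All using (All; []; _∷_)
open import Data.List.Relation.Unary.Any using (here; there)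
open import Data.List.Relation.Unary.AllPairs using ([]; _∷_)
open import Data.List.Relation.Unary.Unique.Propositional using (Unique)
open import Data.List.Relation.Unary.Unique.Propositional.Properties using (Unique[x∷xs]⇒x∉xs)
open import Data.Maybe using (Maybe; just; nothing; is-just)
open import Data.Maybe.Properties as Maybe using (just-injective)
open import Data.Nat using (ℕ; zero; suc; _+_; _∸_; _≤_; s≤s)
open import Data.Nat.Properties
  using (≤-refl; ≤-reflexive; ≤-trans; ≤-antisym; <⇒≢; 1+n≰n; n≤1+n; m≤n⇒m<n∨m≡n; +-suc; +-identityʳ)
open import Data.Product using (∃; _×_; _,_; -,_; proj₁; proj₂)
open import Data.Sum using (_⊎_; inj₁; inj₂)
open import Data.Vec using (_∷_; tabulate; here; there)
open import Data.Vec.Properties using (tabulate-cong; tabulate-∘; lookup∘tabulate; []=⇒lookup; lookup⇒[]=)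
open import Data.Vec.Functional using (Vector; updateAt)
open import Data.Vec.Functional.Properties using (updateAt-updates; updateAt-minimal)
open import Function using (_∘_; const)
open import Function.Bundles using (_⇔_; mk⇔)
open import Function.Definitions using (Injective)
open import Level using (0ℓ)
open import Relation.Binary.PropositionalEquality
open import Relation.Nullary using (yes; no; contradiction)
open import Relation.Unary using (Pred; ∅; ｛_｝; _∪_; _∩_; _⊆_) renaming (∁ to ∁ᵖ)

∣tabulate∣-insert : ∀ {k} (f g : Fin k → Bool) a → (∀ x → x ≢ a → f x ≡ g x) →
                    f a ≡ false → g a ≡ true → ∣ tabulate g ∣ ≡ suc ∣ tabulate f ∣
∣tabulate∣-insert {suc k} f g zero agree fa ga rewrite fa | ga =
  cong (suc ∘ ∣_∣) (tabulate-cong λ x → sym (agree (suc x) λ ()))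
∣tabulate∣-insert {suc k} f g (suc a) agree fa ga rewrite agree zero (λ ()) =
  ∷-suc (g zero) (tabulate (f ∘ suc)) (tabulate (g ∘ suc))
    (∣tabulate∣-insert (f ∘ suc) (g ∘ suc) a (λ x x≢a → agree (suc x) (x≢a ∘ suc-injective)) fa ga)
  where
  ∷-suc : ∀ {k} b (u v : Subset k) → ∣ v ∣ ≡ suc ∣ u ∣ → ∣ b ∷ v ∣ ≡ suc ∣ b ∷ u ∣
  ∷-suc true  _ _ e = cong suc e
  ∷-suc false _ _ e = e

∈-tabulate⁺ : ∀ {k} (f : Fin k → Bool) {x} → f x ≡ true → x ∈ₛ tabulate f
∈-tabulate⁺ f {x} e = lookup⇒[]= x (tabulate f) (trans (lookup∘tabulate f x) e)

∈-tabulate⁻ : ∀ {k} (f : Fin k → Bool) {x} → x ∈ₛ tabulate f → f x ≡ true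
∈-tabulate⁻ f {x} x∈ = trans (sym (lookup∘tabulate f x)) ([]=⇒lookup x∈)

enumerate : ∀ {k} (S : Subset k) → Fin ∣ S ∣ → Fin k
enumerate (true  ∷ S) zero    = zero
enumerate (true  ∷ S) (suc i) = suc (enumerate S i)
enumerate (false ∷ S) i       = suc (enumerate S i)

enumerate-∈ : ∀ {k} (S : Subset k) i → enumerate S i ∈ₛ S
enumerate-∈ (true  ∷ S) zero    = here
enumerate-∈ (true  ∷ S) (suc i) = there (enumerate-∈ S i)
enumerate-∈ (false ∷ S) i       = there (enumerate-∈ S i)

enumerate-injective : ∀ {k} (S : Subset k) → Injective _≡_ _≡_ (enumerate S)
enumerate-injective (true  ∷ S) {zero}  {zero}  _ = refl
enumerate-injective (true  ∷ S) {suc i} {suc j} e = cong suc (enumerate-injective S (suc-injective e))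
enumerate-injective (false ∷ S) e = enumerate-injective S (suc-injective e)

rank : ∀ {k} (S : Subset k) {x} → x ∈ₛ S → Fin ∣ S ∣
rank (true  ∷ S) here      = zero
rank (true  ∷ S) (there x∈) = suc (rank S x∈)
rank (false ∷ S) (there x∈) = rank S x∈

rank-injective : ∀ {k} (S : Subset k) {x y} (x∈ : x ∈ₛ S) (y∈ : y ∈ₛ S) →
                 rank S x∈ ≡ rank S y∈ → x ≡ y
rank-injective (true  ∷ S) here       here       _ = refl
rank-injective (true  ∷ S) (there x∈) (there y∈) e = cong suc (rank-injective S x∈ y∈ (suc-injective e))
rank-injective (false ∷ S) (there x∈) (there y∈) e = cong suc (rank-injective S x∈ y∈ e)

injective-into⇒≤∣∣ : ∀ {j k} (S : Subset k) (g : Fin j → Fin k) → Injective _≡_ _≡_ g →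
                     (∀ i → g i ∈ₛ S) → j ≤ ∣ S ∣
injective-into⇒≤∣∣ S g g-inj g∈ = injective⇒≤ (g-inj ∘ rank-injective S (g∈ _) (g∈ _))

updateAt-const : ∀ {a} {A : Set a} {k} (xs : Vector A k) i y j →
                 (j ≡ i × updateAt xs i (const y) j ≡ y) ⊎ (j ≢ i × updateAt xs i (const y) j ≡ xs j)
updateAt-const xs i y j with j ≟ i
... | yes refl = inj₁ (refl , updateAt-updates i xs)
... | no  j≢i  = inj₂ (j≢i , updateAt-minimal j i xs j≢i)

updateAt-nothing⁻ : ∀ {a} {A : Set a} {k} (xs : Vector (Maybe A) k) i {j y} →
                    updateAt xs i (const nothing) j ≡ just y → xs j ≡ just y
updateAt-nothing⁻ xs i {j} e with updateAt-const xs i nothing j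
... | inj₁ (_ , e′) = contradiction (trans (sym e′) e) λ ()
... | inj₂ (_ , e′) = trans (sym e′) e

updateAt-just⁻ : ∀ {a} {A : Set a} {k} (xs : Vector (Maybe A) k) i {x j y} →
                 updateAt xs i (const (just x)) j ≡ just y → (j ≡ i × x ≡ y) ⊎ xs j ≡ just y
updateAt-just⁻ xs i {j = j} e with updateAt-const xs i _ j
... | inj₁ (j≡i , e′) = inj₁ (j≡i , just-injective (trans (sym e′) e))
... | inj₂ (_   , e′) = inj₂ (trans (sym e′) e)

module _ {n m : ℕ} {adj : BGraph n m} where

  Free : Matching adj → Fin m → Set
  Free N r = ∀ x → mate N x ≢ just r

  ∈-unmatched⁻ : ∀ {M p} → p ∈ₛ unmatched adj M → mate M p ≡ nothing
  ∈-unmatched⁻ {M} {p} p∈ with mate M p | ∈-tabulate⁻ _ p∈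
  ... | nothing | _ = refl

  ∈-unmatched⁺ : ∀ {M p} → mate M p ≡ nothing → p ∈ₛ unmatched adj M
  ∈-unmatched⁺ e = ∈-tabulate⁺ _ (cong (λ v → not (is-just v)) e)

  ∣unmatched∣ : ∀ M → ∣ unmatched adj M ∣ ≡ n ∸ size adj M
  ∣unmatched∣ M = trans (cong ∣_∣ (tabulate-∘ not (is-just ∘ mate M)))
                        (∣∁p∣≡n∸∣p∣ (tabulate (is-just ∘ mate M)))

  unassign : Matching adj → Fin n → Matching adj
  unassign N p = record
    { mate  = updateAt (mate N) p (const nothing)
    ; inE   = λ x r e → inE N x r (updateAt-nothing⁻ (mate N) p e)
    ; injct = λ x y r ex ey → injct N x y r (updateAt-nothing⁻ (mate N) p ex) (updateAt-nothing⁻ (mate N) p ey)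
    }

  assign : (N : Matching adj) (p : Fin n) {r : Fin m} → T (adj p r) → Free N r → Matching adj
  assign N p {r} a r-free = record
    { mate  = updateAt (mate N) p (const (just r))
    ; inE   = edge
    ; injct = injective
    }
    where
    edge : ∀ x r′ → updateAt (mate N) p (const (just r)) x ≡ just r′ → T (adj x r′)
    edge x r′ e with updateAt-just⁻ (mate N) p e
    ... | inj₁ (refl , refl) = a
    ... | inj₂ e′            = inE N x r′ e′
    injective : ∀ x y r′ → updateAt (mate N) p (const (just r)) x ≡ just r′ →
                updateAt (mate N) p (const (just r)) y ≡ just r′ → x ≡ y
    injective x y r′ ex ey with updateAt-just⁻ (mate N) p ex | updateAt-just⁻ (mate N) p ey
    ... | inj₁ (x≡p , _)    | inj₁ (y≡p , _)    = trans x≡p (sym y≡p)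
    ... | inj₁ (_ , refl)   | inj₂ ey′          = ⊥-elim (r-free y ey′)
    ... | inj₂ ex′          | inj₁ (_ , refl)   = ⊥-elim (r-free x ex′)
    ... | inj₂ ex′          | inj₂ ey′          = injct N x y r′ ex′ ey′

  size-unassign : ∀ N {p r} → mate N p ≡ just r → size adj N ≡ suc (size adj (unassign N p))
  size-unassign N {p} e = ∣tabulate∣-insert _ _ p
    (λ x x≢p → cong is-just (updateAt-minimal x p (mate N) x≢p))
    (cong is-just (updateAt-updates p (mate N))) (cong is-just e)

  size-assign : ∀ N {p r} (a : T (adj p r)) (r-free : Free N r) → mate N p ≡ nothing →
                size adj (assign N p a r-free) ≡ suc (size adj N)
  size-assign N {p} _ _ e = ∣tabulate∣-insert _ _ p
    (λ x x≢p → cong is-just (sym (updateAt-minimal x p (mate N) x≢p)))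
    (cong is-just e) (cong is-just (updateAt-updates p (mate N)))

  -- The result of flipping N along alternating paths whose players are the touched ones.
  record Rerouting (N : Matching adj) (touched freed : Pred (Fin n) 0ℓ) : Set where
    field
      matching        : Matching adj
      same-size       : size adj matching ≡ size adj N
      frees           : freed ⊆ λ x → mate matching x ≡ nothing
      untouched       : ∁ᵖ touched ⊆ λ x → mate matching x ≡ mate N x
      no-new-resource : ∀ {x r} → mate matching x ≡ just r → ∃ λ y → mate N y ≡ just r
  open Rerouting

  reroute-refl : ∀ {N} → Rerouting N ∅ (λ x → mate N x ≡ nothing)
  reroute-refl {N} = record
    { matching = N ; same-size = refl ; frees = λ e → e ; untouched = λ _ → refl ; no-new-resource = -,_ }

  reroute-weaken : ∀ {N t t′ f f′} → Rerouting N t f → t ⊆ t′ → f′ ⊆ f → Rerouting N t′ f′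
  reroute-weaken R t⊆t′ f′⊆f = record
    { matching = matching R ; same-size = same-size R ; frees = frees R ∘ f′⊆f
    ; untouched = λ x∉t′ → untouched R (x∉t′ ∘ t⊆t′) ; no-new-resource = no-new-resource R }

  reroute-trans : ∀ {N t₁ t₂ f₁ f₂} (R : Rerouting N t₁ f₁) → Rerouting (matching R) t₂ f₂ →
                  Rerouting N (t₁ ∪ t₂) ((f₁ ∩ ∁ᵖ t₂) ∪ f₂)
  reroute-trans R₁ R₂ = record
    { matching = matching R₂
    ; same-size = trans (same-size R₂) (same-size R₁)
    ; frees = λ { (inj₁ (x∈f₁ , x∉t₂)) → trans (untouched R₂ x∉t₂) (frees R₁ x∈f₁)
                ; (inj₂ x∈f₂)          → frees R₂ x∈f₂ }
    ; untouched = λ x∉t → trans (untouched R₂ (x∉t ∘ inj₂)) (untouched R₁ (x∉t ∘ inj₁))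
    ; no-new-resource = λ e → no-new-resource R₁ (proj₂ (no-new-resource R₂ e))
    }

  reroute-shift : ∀ {N p p′ r} → mate N p ≡ nothing → T (adj p r) → mate N p′ ≡ just r →
                  Rerouting N (｛ p ｝ ∪ ｛ p′ ｝) ｛ p′ ｝
  reroute-shift {N} {p} {p′} {r} p-free a p′↦r = record
    { matching = N₁
    ; same-size = trans (size-assign N₀ a r-free (trans (updateAt-minimal p p′ (mate N) p≢p′) p-free))
                        (sym (size-unassign N p′↦r))
    ; frees = λ { refl → trans (updateAt-minimal p′ p (mate N₀) (p≢p′ ∘ sym))
                               (updateAt-updates p′ (mate N)) }
    ; untouched = λ {x} x∉ → trans (updateAt-minimal x p (mate N₀) (x∉ ∘ inj₁ ∘ sym))
                                   (updateAt-minimal x p′ (mate N) (x∉ ∘ inj₂ ∘ sym))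
    ; no-new-resource = reused
    }
    where
    p≢p′ : p ≢ p′
    p≢p′ refl = contradiction (trans (sym p-free) p′↦r) λ ()
    N₀ : Matching adj
    N₀ = unassign N p′
    r-free : Free N₀ r
    r-free x e with injct N x p′ r (updateAt-nothing⁻ (mate N) p′ e) p′↦r
    ... | refl = contradiction (trans (sym (updateAt-updates p′ (mate N))) e) λ ()
    N₁ : Matching adj
    N₁ = assign N₀ p a r-free
    reused : ∀ {x r′} → mate N₁ x ≡ just r′ → ∃ λ y → mate N y ≡ just r′
    reused e with updateAt-just⁻ (mate N₀) p e
    ... | inj₁ (_ , refl) = p′ , p′↦r
    ... | inj₂ e′         = -, updateAt-nothing⁻ (mate N) p′ e′

  first∈ : ∀ {M u v} (w : Walk adj M u v) → u ∈ vertices adj w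
  first∈ []      = here refl
  first∈ (_ ∷ _) = here refl

  last∈ : ∀ {M u v} (w : Walk adj M u v) → v ∈ vertices adj w
  last∈ []      = here refl
  last∈ (_ ∷ w) = there (last∈ w)

  -- N may differ from M at p: after the first exchange the next start is free in N, matched in M.
  reroute-along : ∀ {M N p q} (w : Walk adj M (inj₁ p) (inj₁ q)) → Unique (vertices adj w) →
                  mate N p ≡ nothing →
                  (∀ {x} → inj₁ x ∈ vertices adj w → x ≢ p → mate N x ≡ mate M x) →
                  Rerouting N (λ x → inj₁ x ∈ vertices adj w) ｛ q ｝
  reroute-along [] _ p-free _ = reroute-weaken reroute-refl (λ ()) λ { refl → p-free }
  reroute-along {M} {N} {p} (fwd a _ ∷ (bwd {p′} p′↦r ∷ w)) u@(_ ∷ _ ∷ u′) p-free agrees =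
    reroute-weaken (reroute-trans S (reroute-along w u′ (frees S refl) agrees′))
      (λ { (inj₁ (inj₁ refl)) → here refl
         ; (inj₁ (inj₂ refl)) → there (there (first∈ w))
         ; (inj₂ x∈w)         → there (there x∈w) })
      inj₂
    where
    p∉w : inj₁ p ∉ vertices adj w
    p∉w = Unique[x∷xs]⇒x∉xs u ∘ there
    p′≢p : p′ ≢ p
    p′≢p refl = p∉w (first∈ w)
    S : Rerouting N (｛ p ｝ ∪ ｛ p′ ｝) ｛ p′ ｝
    S = reroute-shift p-free a (trans (agrees (there (there (first∈ w))) p′≢p) p′↦r)
    agrees′ : ∀ {x} → inj₁ x ∈ vertices adj w → x ≢ p′ → mate (matching S) x ≡ mate M x
    agrees′ x∈w x≢p′ = trans (untouched S λ { (inj₁ refl) → p∉w x∈w ; (inj₂ refl) → x≢p′ refl })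
                             (agrees (there (there x∈w)) λ { refl → p∉w x∈w })

  no-augmenting-walk : ∀ {A p q r} → IsMaximum adj A → (w : Walk adj A (inj₁ p) (inj₁ q)) →
                       Unique (vertices adj w) → mate A p ≡ nothing → T (adj q r) → Free A r → ⊥
  no-augmenting-walk {A} {q = q} {r} A-max w u p-free a r-free =
    1+n≰n (subst (_≤ size adj A) grows (A-max (assign N q a r-free′)))
    where
    R : Rerouting A (λ x → inj₁ x ∈ vertices adj w) ｛ q ｝
    R = reroute-along w u p-free λ _ _ → refl
    N : Matching adj
    N = matching R
    r-free′ : Free N r
    r-free′ x e = let y , e′ = no-new-resource R e in r-free y e′
    grows : size adj (assign N q a r-free′) ≡ suc (size adj A)
    grows = trans (size-assign N a r-free′ (frees R refl)) (cong suc (same-size R))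

module Alternation {n m : ℕ} {adj : BGraph n m} (A B : Matching adj) where

  -- Reach p d z : z is the d-th vertex of the alternating path of A ⊕ B starting at the A-free
  -- player p, which leaves players along B and enters them along A.
  data Reach (p : Fin n) : ℕ → V adj → Set where
    start : mate A p ≡ nothing → Reach p 0 (inj₁ p)
    viaB  : ∀ {d x r} → Reach p d (inj₁ x) → mate B x ≡ just r → Reach p (suc d) (inj₂ r)
    viaA  : ∀ {d y r} → Reach p d (inj₂ r) → mate A y ≡ just r → Reach p (suc d) (inj₁ y)

  reach-determined : ∀ {p p′ d d′ z} → Reach p d z → Reach p′ d′ z → p ≡ p′ × d ≡ d′
  reach-determined (start _)   (start _)   = refl , refl
  reach-determined (start p↦∅) (viaA _ p↦r) = contradiction (trans (sym p↦∅) p↦r) λ ()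
  reach-determined (viaA _ p↦r) (start p↦∅) = contradiction (trans (sym p↦∅) p↦r) λ ()
  reach-determined (viaB D x↦r) (viaB D′ x′↦r) with injct B _ _ _ x↦r x′↦r
  ... | refl = let p≡p′ , d≡d′ = reach-determined D D′ in p≡p′ , cong suc d≡d′
  reach-determined (viaA D y↦r) (viaA D′ y↦r′) with just-injective (trans (sym y↦r) y↦r′)
  ... | refl = let p≡p′ , d≡d′ = reach-determined D D′ in p≡p′ , cong suc d≡d′

  reach-≢ : ∀ {p p′ d d′ z z′} → Reach p d z → Reach p′ d′ z′ → d ≢ d′ → z ≢ z′
  reach-≢ D D′ d≢d′ refl = d≢d′ (proj₂ (reach-determined D D′))

  origin-free : ∀ {p d z} → Reach p d z → mate A p ≡ nothing
  origin-free (start p-free) = p-free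
  origin-free (viaB D _)     = origin-free D
  origin-free (viaA D _)     = origin-free D

  prefix : ∀ {p d i z} → Reach p d z → i ≤ d → ∃ (Reach p i)
  prefix D i≤d with m≤n⇒m<n∨m≡n i≤d
  ... | inj₂ refl = -, D
  prefix (viaB D _) _ | inj₁ (s≤s i≤d) = prefix D i≤d
  prefix (viaA D _) _ | inj₁ (s≤s i≤d) = prefix D i≤d

  depth-bound : ∀ {p d z} → Reach p d z → suc d ≤ n + m
  depth-bound {d = d} D = injective⇒≤ {f = position} λ {i} {j} e →
    toℕ-injective (proj₂ (reach-determined (proj₂ (at i))
      (subst (Reach _ _) (sym (vertex-injective {i} {j} e)) (proj₂ (at j)))))
    where
    at : (i : Fin (suc d)) → ∃ (Reach _ (toℕ i))
    at i = prefix D (toℕ≤pred[n] i)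
    position : Fin (suc d) → Fin (n + m)
    position i = join n m (proj₁ (at i))
    vertex-injective : ∀ {i j} → position i ≡ position j → proj₁ (at i) ≡ proj₁ (at j)
    vertex-injective {i} {j} e =
      trans (sym (splitAt-join n m (proj₁ (at i)))) (trans (cong (splitAt n) e) (splitAt-join n m (proj₁ (at j))))

  step-moves : ∀ {p d x y r} → Reach p d (inj₁ x) → mate B x ≡ just r → mate A y ≡ just r → x ≢ y
  step-moves D x↦r y↦r refl = reach-≢ D (viaA (viaB D x↦r) y↦r) (<⇒≢ (n≤1+n _)) refl

  forward : ∀ {p d q v} → Reach p d (inj₁ q) → Walk adj A (inj₁ q) v → Walk adj A (inj₁ p) v
  forward (start _) w = w
  forward (viaA (viaB D x↦r) y↦r) w =
    forward D (fwd (inE B _ _ x↦r) (λ x↦ᴬr → step-moves D x↦r y↦r (injct A _ _ _ x↦ᴬr y↦r))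
               ∷ (bwd y↦r ∷ w))

  backward : ∀ {p d q} → Reach p d (inj₁ q) → Walk adj B (inj₁ q) (inj₁ p)
  backward (start _) = []
  backward (viaA (viaB D x↦r) y↦r) =
    fwd (inE A _ _ y↦r) (λ y↦ᴮr → step-moves D x↦r y↦r (injct B _ _ _ x↦r y↦ᴮr))
    ∷ (bwd x↦r ∷ backward D)

  Beyond Within : Fin n → ℕ → V adj → Set
  Beyond p d z = ∃ λ d′ → d ≤ d′ × Reach p d′ z
  Within p d z = ∃ λ d′ → d′ ≤ d × Reach p d′ z

  beyond-weaken : ∀ {p d d′} → d ≤ d′ → Beyond p d′ ⊆ Beyond p d
  beyond-weaken d≤d′ (d″ , d′≤d″ , D) = d″ , ≤-trans d≤d′ d′≤d″ , D

  within-weaken : ∀ {p d d′} → d ≤ d′ → Within p d ⊆ Within p d′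
  within-weaken d≤d′ (d″ , d″≤d , D) = d″ , ≤-trans d″≤d d≤d′ , D

  fresh-before : ∀ {p d z zs} → Reach p d z → All (Beyond p (suc d)) zs → All (z ≢_) zs
  fresh-before D = All.map λ (_ , d< , D′) → reach-≢ D D′ (<⇒≢ d<)

  fresh-after : ∀ {p d z zs} → Reach p (suc d) z → All (Within p d) zs → All (z ≢_) zs
  fresh-after D = All.map λ (_ , ≤d , D′) → reach-≢ D D′ (<⇒≢ (s≤s ≤d) ∘ sym)

  forward-simple : ∀ {p d q v} (D : Reach p d (inj₁ q)) {w : Walk adj A (inj₁ q) v} →
                   All (Beyond p d) (vertices adj w) → Unique (vertices adj w) →
                   All (Beyond p 0) (vertices adj (forward D w)) × Unique (vertices adj (forward D w))
  forward-simple (start _) beyond u = beyond , u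
  forward-simple (viaA (viaB {d} D x↦r) y↦r) beyond u =
    forward-simple D ((d , ≤-refl , D) ∷ All.map (beyond-weaken (n≤1+n d)) r∷beyond)
      (fresh-before D r∷beyond ∷ fresh-before (viaB D x↦r) beyond ∷ u)
    where
    r∷beyond : All (Beyond _ (suc d)) (inj₂ _ ∷ vertices adj _)
    r∷beyond = (suc d , ≤-refl , viaB D x↦r) ∷ All.map (beyond-weaken (n≤1+n (suc d))) beyond

  backward-simple : ∀ {p d q} (D : Reach p d (inj₁ q)) →
                    All (Within p d) (vertices adj (backward D)) × Unique (vertices adj (backward D))
  backward-simple D@(start _) = ((0 , ≤-refl , D) ∷ []) , ([] ∷ [])
  backward-simple D@(viaA (viaB {d} D′ x↦r) y↦r) =
    ((suc (suc d) , ≤-refl , D) ∷ All.map (within-weaken (n≤1+n (suc d))) r∷within) ,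
    (fresh-after D r∷within ∷ fresh-after (viaB D′ x↦r) within ∷ u)
    where
    within : All (Within _ d) (vertices adj (backward D′))
    within = proj₁ (backward-simple D′)
    u : Unique (vertices adj (backward D′))
    u = proj₂ (backward-simple D′)
    r∷within : All (Within _ (suc d)) (inj₂ _ ∷ vertices adj (backward D′))
    r∷within = (suc d , ≤-refl , viaB D′ x↦r) ∷ All.map (within-weaken (n≤1+n d)) within

  forward-simple₀ : ∀ {p d q} (D : Reach p d (inj₁ q)) →
                    All (Beyond p 0) (vertices adj (forward D [])) × Unique (vertices adj (forward D []))
  forward-simple₀ D = forward-simple D ((_ , ≤-refl , D) ∷ []) ([] ∷ [])

  forward-unique : ∀ {p d q} (D : Reach p d (inj₁ q)) → Unique (vertices adj (forward D []))
  forward-unique D = proj₂ (forward-simple₀ D)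

  backward-unique : ∀ {p d q} (D : Reach p d (inj₁ q)) → Unique (vertices adj (backward D))
  backward-unique D = proj₂ (backward-simple D)

  forward-meet : ∀ {p p′ d d′ q q′ z} (D : Reach p d (inj₁ q)) (D′ : Reach p′ d′ (inj₁ q′)) →
                 z ∈ vertices adj (forward D []) → z ∈ vertices adj (forward D′ []) → p ≡ p′
  forward-meet D D′ z∈ z∈′ =
    let _ , _ , E = All.lookup (proj₁ (forward-simple₀ D)) z∈
        _ , _ , E′ = All.lookup (proj₁ (forward-simple₀ D′)) z∈′
    in proj₁ (reach-determined E E′)

  backward-meet : ∀ {p p′ d d′ q q′ z} (D : Reach p d (inj₁ q)) (D′ : Reach p′ d′ (inj₁ q′)) →
                  z ∈ vertices adj (backward D) → z ∈ vertices adj (backward D′) → p ≡ p′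
  backward-meet D D′ z∈ z∈′ =
    let _ , _ , E = All.lookup (proj₁ (backward-simple D)) z∈
        _ , _ , E′ = All.lookup (proj₁ (backward-simple D′)) z∈′
    in proj₁ (reach-determined E E′)

  record Chain (p : Fin n) : Set where
    field
      {depth}  : ℕ
      {end}    : Fin n
      reach    : Reach p depth (inj₁ end)
      end-free : mate B end ≡ nothing

  chain : IsMaximum adj A → ∀ {p} → mate A p ≡ nothing → Chain p
  chain A-max p-free = extend (n + m) ≤-refl (start p-free)
    where
    extend : ∀ {p d q} fuel → n + m ≤ d + fuel → Reach p d (inj₁ q) → Chain p
    extend {d = d} zero enough D =
      ⊥-elim (1+n≰n (≤-trans (depth-bound D) (≤-trans enough (≤-reflexive (+-identityʳ d)))))
    extend {d = d} {q} (suc fuel) enough D with mate B q in q↦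
    ... | nothing = record { reach = D ; end-free = q↦ }
    ... | just r with any? (λ y → Maybe.≡-dec _≟_ (mate A y) (just r))
    ...   | yes (y , y↦r) = extend fuel (≤-trans enough (≤-trans (≤-reflexive (+-suc d fuel)) (n≤1+n _)))
                                    (viaA (viaB D q↦) y↦r)
    ...   | no r-free     = ⊥-elim (no-augmenting-walk A-max (forward D []) (forward-unique D) (origin-free D)
                                      (inE B q r q↦) λ y y↦r → r-free (y , y↦r))

module _ {n m : ℕ} {adj : BGraph n m} where
  open Rerouting

  shared⇒≡ : ∀ {M S T k} (P : DisjointPaths adj M S T k) {i j z} →
             z ∈ vertices adj (walk (proj₁ P i)) → z ∈ vertices adj (walk (proj₁ P j)) → i ≡ j
  shared⇒≡ (_ , disjoint) {i} {j} z∈i z∈j with i ≟ j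
  ... | yes i≡j = i≡j
  ... | no  i≢j = ⊥-elim (disjoint i j i≢j _ z∈i z∈j)

  src-injective : ∀ {M S T k} (P : DisjointPaths adj M S T k) → Injective _≡_ _≡_ (src ∘ proj₁ P)
  src-injective P {i} {j} e = shared⇒≡ P (first∈ (walk (proj₁ P i)))
    (subst (λ x → inj₁ x ∈ vertices adj (walk (proj₁ P j))) (sym e) (first∈ _))

  tgt-injective : ∀ {M S T k} (P : DisjointPaths adj M S T k) → Injective _≡_ _≡_ (tgt ∘ proj₁ P)
  tgt-injective P {i} {j} e = shared⇒≡ P (last∈ (walk (proj₁ P i)))
    (subst (λ x → inj₁ x ∈ vertices adj (walk (proj₁ P j))) (sym e) (last∈ _))

  players targets : ∀ {M S T k} → DisjointPaths adj M S T k → Pred (Fin n) 0ℓ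
  players P x = ∃ λ i → inj₁ x ∈ vertices adj (walk (proj₁ P i))
  targets P x = ∃ λ i → tgt (proj₁ P i) ≡ x

  ≤∣sources∣ : ∀ {M S T k} → DisjointPaths adj M S T k → k ≤ ∣ S ∣
  ≤∣sources∣ P = injective-into⇒≤∣∣ _ _ (src-injective P) (src∈S ∘ proj₁ P)

  reroute-all : ∀ {M N T k} (P : DisjointPaths adj M (unmatched adj M) T k) →
                (∀ {i x} → inj₁ x ∈ vertices adj (walk (proj₁ P i)) → mate N x ≡ mate M x) →
                Rerouting N (players P) (targets P)
  reroute-all {k = zero}  _ _ = reroute-weaken reroute-refl (λ ()) λ { (() , _) }
  reroute-all {M} {N} {k = suc k} (π , disjoint) agrees =
    reroute-weaken (reroute-trans R₀ (reroute-all (π ∘ suc , disjoint′) agrees′))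
      (λ { (inj₁ x∈) → zero , x∈ ; (inj₂ (i , x∈)) → suc i , x∈ })
      (λ { (zero , refl) → inj₁ (refl , λ (i , x∈) → apart i (last∈ (walk (π zero))) x∈)
         ; (suc i , e)   → inj₂ (i , e) })
    where
    apart : ∀ i {z} → z ∈ vertices adj (walk (π zero)) → z ∉ vertices adj (walk (π (suc i)))
    apart i = disjoint zero (suc i) (λ ()) _
    disjoint′ : ∀ i j → i ≢ j → Disjoint adj (π (suc i)) (π (suc j))
    disjoint′ i j i≢j = disjoint (suc i) (suc j) (i≢j ∘ suc-injective)
    R₀ : Rerouting N (λ x → inj₁ x ∈ vertices adj (walk (π zero))) ｛ tgt (π zero) ｝
    R₀ = reroute-along (walk (π zero)) (simple (π zero))
           (trans (agrees {zero} (first∈ (walk (π zero)))) (∈-unmatched⁻ {M = M} (src∈S (π zero))))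
           λ x∈ _ → agrees x∈
    agrees′ : ∀ {i x} → inj₁ x ∈ vertices adj (walk (π (suc i))) → mate (matching R₀) x ≡ mate M x
    agrees′ {i} x∈ = trans (untouched R₀ λ x∈₀ → apart i x∈₀ x∈) (agrees x∈)

  unmatched-linkage : ∀ {M} M′ → IsMaximum adj M →
                      DisjointPaths adj M (unmatched adj M) (unmatched adj M′) ∣ unmatched adj M ∣
  unmatched-linkage {M} M′ M-max = π , disjoint
    where
    open Alternation M M′
    open Chain
    S : Subset n
    S = unmatched adj M
    chainᵢ : ∀ i → Chain (enumerate S i)
    chainᵢ i = chain M-max (∈-unmatched⁻ {M = M} (enumerate-∈ S i))
    π : Fin ∣ S ∣ → SPath adj M S (unmatched adj M′)
    π i = record
      { src = enumerate S i ; tgt = end (chainᵢ i)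
      ; src∈S = enumerate-∈ S i ; tgt∈T = ∈-unmatched⁺ {M = M′} (end-free (chainᵢ i))
      ; walk = forward (reach (chainᵢ i)) [] ; simple = forward-unique (reach (chainᵢ i)) }
    disjoint : ∀ i j → i ≢ j → Disjoint adj (π i) (π j)
    disjoint i j i≢j _ z∈i z∈j = i≢j (enumerate-injective S (forward-meet (reach (chainᵢ i)) (reach (chainᵢ j)) z∈i z∈j))

  linkage-transfer : ∀ {M} M′ {T k} → IsMaximum adj M →
                     DisjointPaths adj M (unmatched adj M) T k → DisjointPaths adj M′ (unmatched adj M′) T k
  linkage-transfer {M} M′ {T} M-max P@(π , _) = ρ , disjoint
    where
    R : Rerouting M (players P) (targets P)
    R = reroute-all P λ _ → refl
    N : Matching adj
    N = matching R
    N-max : IsMaximum adj N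
    N-max M″ = subst (size adj M″ ≤_) (sym (same-size R)) (M-max M″)
    open Alternation N M′
    open Chain
    chainᵢ : ∀ i → Chain (tgt (π i))
    chainᵢ i = chain N-max (frees R (i , refl))
    ρ : ∀ i → SPath adj M′ (unmatched adj M′) T
    ρ i = record
      { src = end (chainᵢ i) ; tgt = tgt (π i)
      ; src∈S = ∈-unmatched⁺ {M = M′} (end-free (chainᵢ i)) ; tgt∈T = tgt∈T (π i)
      ; walk = backward (reach (chainᵢ i)) ; simple = backward-unique (reach (chainᵢ i)) }
    disjoint : ∀ i j → i ≢ j → Disjoint adj (ρ i) (ρ j)
    disjoint i j i≢j _ z∈i z∈j = i≢j (tgt-injective P (backward-meet (reach (chainᵢ i)) (reach (chainᵢ j)) z∈i z∈j))

greatest-⇔ : ∀ {P Q : ℕ → Set} → (∀ {k} → P k → Q k) → (∀ {k} → Q k → P k) →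
             ∀ {k} → (P k × (∀ k′ → P k′ → k′ ≤ k)) ⇔ (Q k × (∀ k′ → Q k′ → k′ ≤ k))
greatest-⇔ P⇒Q Q⇒P = mk⇔ (λ (p , max) → P⇒Q p , λ k′ → max k′ ∘ Q⇒P)
                         (λ (q , max) → Q⇒P q , λ k′ → max k′ ∘ P⇒Q)

claim4 : ∀ {n m : ℕ} (adj : BGraph n m) (M M' : Matching adj) →
         IsMaximum adj M → IsMaximum adj M' →
         (fIs adj M (unmatched adj M) (unmatched adj M') ∣ unmatched adj M ∣
            × ∣ unmatched adj M ∣ ≡ ∣ unmatched adj M' ∣)
         × (∀ (T : Subset n) (k : ℕ) →
              fIs adj M (unmatched adj M) T k ⇔ fIs adj M' (unmatched adj M') T k)
claim4 {n} adj M M' M-max M'-max =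
  ((unmatched-linkage M' M-max , λ _ → ≤∣sources∣) , same-deficiency)
  , λ T k → greatest-⇔ (linkage-transfer M' M-max) (linkage-transfer M M'-max)
  where
  same-deficiency : ∣ unmatched adj M ∣ ≡ ∣ unmatched adj M' ∣
  same-deficiency = begin
    ∣ unmatched adj M ∣  ≡⟨ ∣unmatched∣ M ⟩
    n ∸ size adj M       ≡⟨ cong (n ∸_) (≤-antisym (M'-max M) (M-max M')) ⟩
    n ∸ size adj M'      ≡⟨ ∣unmatched∣ M' ⟨
    ∣ unmatched adj M' ∣ ∎
    where open ≡-Reasoning
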